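{- Let $\Gamma$ be a finitely generated abelian group, $\mathcal{A}$ a finite list of elements of $\Gamma$, and fix $\alpha\in\mathcal{A}$. Let $\mathcal{A}':=\mathcal{A}\smallsetminus\{\alpha\}$ (a list in $\Gamma$) and $\mathcal{A}'':=\mathcal{A}/\{\alpha\}$ (a list in $\Gamma/\langle\alpha\rangle$). If $k$ is a positive integer with $k\le\min\{\rho_{\mathcal{A}'},\rho_{\mathcal{A}''}\}$, then $$f^k_{\mathcal{A}}(t)=f^k_{\mathcal{A}'}(t)-f^k_{\mathcal{A}''}(t).$$
   Context: For a finite list $\mathcal{S}$ in an abelian group, $\langle\mathcal{S}\rangle$ is the generated subgroup and $r_{\mathcal{S}}$ its rank. For a finite list $\mathcal{A}$ in a finitely generated abelian group $\Gamma$ and each sublist $\mathcal{S}\subseteq\mathcal{A}$, write $\Gamma/\langle\mathcal{S}\rangle\simeq\bigoplus_{i=1}^{n_{\mathcal{S}}}\mathbb{Z}/d_{\mathcal{S},i}\mathbb{Z}\oplus\mathbb{Z}^{r_\Gamma-r_{\mathcal{S}}}$ with $n_{\mathcal{S}}\ge0$ and $1<d_{\mathcal{S},i}\mid d_{\mathcal{S},i+1}$ (with $d_{\mathcal{S},n_{\mathcal{S}}}:=1$ if $n_{\mathcal{S}}=0$); the LCM-period is $\rho_{\mathcal{A}}:=\operatorname{lcm}(d_{\mathcal{S},n_{\mathcal{S}}}\mid\mathcal{S}\subseteq\mathcal{A})$. The chromatic quasi-polynomial is $\chi^{\mathrm{quasi}}_{\mathcal{A}}(q):=\#\{\varphi\in\operatorname{Hom}(\Gamma,\mathbb{Z}/q\mathbb{Z})\mid\varphi(\beta)\neq\overline0\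 \forall\beta\in\mathcal{A}\}$; it is known to be a quasi-polynomial in $q$ with period $\rho_{\mathcal{A}}$, i.e. for each $1\le k\le\rho_{\mathcal{A}}$ there is a polynomial $f^k_{\mathcal{A}}(t)\in\mathbb{Z}[t]$ (the $k$-constituent) with $\chi^{\mathrm{quasi}}_{\mathcal{A}}(q)=f^k_{\mathcal{A}}(q)$ for all $q\in\mathbb{Z}_{>0}$ with $q\equiv k\bmod\rho_{\mathcal{A}}$. Constituents of $\mathcal{A}'$ and $\mathcal{A}''$ are taken with respect to their own LCM-periods $\rho_{\mathcal{A}'}$, $\rho_{\mathcal{A}''}$ (in their respective groups). The contraction $\mathcal{A}/\{\alpha\}$ is the list of cosets $\{\overline\beta\mid\beta\in\mathcal{A}\smallsetminus\{\alpha\}\}$ in $\Gamma/\langle\alpha\rangle$. -}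

module Defs where

open import Data.Bool using (Bool; true; false; _∧_; not; if_then_else_)
open import Data.Nat as ℕ using (ℕ; zero; suc; NonZero; _<_; _≡ᵇ_)
open import Data.Nat.Divisibility as ℕD using ()
open import Data.Integer as ℤ using (ℤ; +_; 0ℤ; 1ℤ; _-_)
open import Data.Integer.DivMod using (_%ℕ_)
open import Data.Integer.Divisibility as ℤD using ()
open import Data.Fin as Fin using (Fin; toℕ; _↑ˡ_)
open import Data.Vec as Vec using (Vec; []; _∷_)
open import Data.List as List using (List; []; _∷_; length; _++_)
open import Data.List.Relation.Unary.All using (All)
open import Data.List.Relation.Unary.Linked using (Linked)
open import Data.Product using (Σ; _×_)
open import Relation.Nullary using (does)
open import Relation.Binary.PropositionalEquality using (_≡_)

dot : ∀ {m} → Vec ℤ m → Vec ℤ m → ℤ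
dot [] [] = 0ℤ
dot (x ∷ xs) (y ∷ ys) = x ℤ.* y ℤ.+ dot xs ys

vsub : ∀ {m} → Vec ℤ m → Vec ℤ m → Vec ℤ m
vsub = Vec.zipWith _-_

basis : ∀ {m} → Fin m → Vec ℤ m
basis j = Vec.tabulate (λ i → if does (i Fin.≟ j) then 1ℤ else 0ℤ)

lincomb : ∀ {m} (rs : List (Vec ℤ m)) → Vec ℤ (length rs) → Vec ℤ m
lincomb {m} [] [] = Vec.replicate m 0ℤ
lincomb (r ∷ rs) (c ∷ cs) = Vec.zipWith ℤ._+_ (Vec.map (c ℤ.*_) r) (lincomb rs cs)

InSpan : ∀ {m} → List (Vec ℤ m) → Vec ℤ m → Set
InSpan R v = Σ (Vec ℤ (length R)) λ c → lincomb R c ≡ v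

Mat : ℕ → ℕ → Set
Mat m' m = Vec (Vec ℤ m) m'

apply : ∀ {m m'} → Mat m' m → Vec ℤ m → Vec ℤ m'
apply F v = Vec.map (λ row → dot row v) F

-- Finitely presented abelian groups.
-- A list R : List (Vec ℤ m) presents the group ℤ^m / ⟨R⟩; an element of
-- the group is represented by a vector of ℤ^m.

-- Isomorphism of presented groups  ℤ^m/⟨R⟩ ≅ ℤ^m'/⟨R'⟩, given by lifts F, G
-- of mutually inverse homomorphisms (every homomorphism out of ℤ^m/⟨R⟩
-- lifts to ℤ^m since ℤ^m is free).
IsIso : (m : ℕ) → List (Vec ℤ m) → (m' : ℕ) → List (Vec ℤ m') → Set
IsIso m R m' R' =
  Σ (Mat m' m) λ F → Σ (Mat m m') λ G →
    All (λ v → InSpan R' (apply F v)) R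
  × All (λ v → InSpan R (apply G v)) R'
  × (∀ j → InSpan R (vsub (apply G (apply F (basis j))) (basis j)))
  × (∀ j → InSpan R' (vsub (apply F (apply G (basis j))) (basis j)))

-- relations of  ⊕_{i} ℤ/d_iℤ ⊕ ℤ^r  presented on ℤ^(n+r), n = length ds
diagRels : (ds : List ℕ) (r : ℕ) → List (Vec ℤ (length ds ℕ.+ r))
diagRels ds r =
  List.tabulate (λ (i : Fin (length ds)) →
    Vec.map ((+ List.lookup ds i) ℤ.*_) (basis (i ↑ˡ r)))

-- d_{n} with the convention d_{n} := 1 if the list is empty
lastOr1 : List ℕ → ℕ
lastOr1 [] = 1
lastOr1 (d ∷ []) = d
lastOr1 (d ∷ e ∷ ds) = lastOr1 (e ∷ ds)

-- d is the last invariant factor d_{n} of ℤ^m/⟨R⟩ :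
--   ℤ^m/⟨R⟩ ≃ ⊕_{i=1}^{n} ℤ/d_iℤ ⊕ ℤ^r  with 1 < d_i ∣ d_{i+1}, and d = d_n
--   (d = 1 if n = 0)
IsLastInvFactor : (m : ℕ) → List (Vec ℤ m) → ℕ → Set
IsLastInvFactor m R d =
  Σ (List ℕ) λ ds → Σ ℕ λ r →
    All (1 <_) ds × Linked ℕD._∣_ ds
  × IsIso m R (length ds ℕ.+ r) (diagRels ds r)
  × d ≡ lastOr1 ds

select : ∀ {a} {X : Set a} (xs : List X) → Vec Bool (length xs) → List X
select [] [] = []
select (x ∷ xs) (true ∷ s) = x ∷ select xs s
select (x ∷ xs) (false ∷ s) = select xs s

-- ρ is the LCM-period of the list A in ℤ^m/⟨R⟩ :
--   ρ = lcm of d_{S,n_S} over all sublists S ⊆ A,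
--   where Γ/⟨S⟩ is presented by S ++ R.
IsLCMPeriod : (m : ℕ) → List (Vec ℤ m) → List (Vec ℤ m) → ℕ → Set
IsLCMPeriod m R A ρ =
  Σ (Vec Bool (length A) → ℕ) λ d →
    (∀ s → IsLastInvFactor m (select A s ++ R) (d s))
  × (∀ s → d s ℕD.∣ ρ)
  × (∀ c → (∀ s → d s ℕD.∣ c) → ρ ℕD.∣ c)

allVecs : (q m : ℕ) → List (Vec (Fin q) m)
allVecs q zero = [] ∷ []
allVecs q (suc m) =
  List.concatMap (λ x → List.map (x ∷_) (allVecs q m)) (List.allFin q)

-- φ(v) mod q is zero, where φ : ℤ^m → ℤ/qℤ has values c on the basis
isZeroAt : ∀ {m} (q : ℕ) .{{_ : NonZero q}} → Vec (Fin q) m → Vec ℤ m → Bool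
isZeroAt q c v = (dot (Vec.map (λ x → + toℕ x) c) v %ℕ q) ≡ᵇ 0

allᵇ : ∀ {a} {X : Set a} → (X → Bool) → List X → Bool
allᵇ p [] = true
allᵇ p (x ∷ xs) = p x ∧ allᵇ p xs

-- Hom(ℤ^m/⟨R⟩, ℤ/qℤ) = {c ∈ (ℤ/qℤ)^m | c kills every relation};
-- χ^quasi_A(q) = #{φ ∈ Hom | φ(β) ≠ 0 for all β ∈ A}
chi : (m : ℕ) → List (Vec ℤ m) → List (Vec ℤ m) → (q : ℕ) → .{{_ : NonZero q}} → ℕ
chi m R A q = length (List.filterᵇ good (allVecs q m))
  where
  good : Vec (Fin q) m → Bool
  good c = allᵇ (isZeroAt q c) R ∧ allᵇ (λ b → not (isZeroAt q c b)) A

-- Polynomials in ℤ[t] as ascending coefficient lists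

eval : List ℤ → ℤ → ℤ
eval [] t = 0ℤ
eval (a ∷ as) t = a ℤ.+ t ℤ.* eval as t

IsConstituent : (m : ℕ) → List (Vec ℤ m) → List (Vec ℤ m) → (ρ k : ℕ) → List ℤ → Set
IsConstituent m R A ρ k P =
  ∀ q → .{{_ : NonZero q}} → (+ ρ) ℤD.∣ (+ q - + k) → eval P (+ q) ≡ + chi m R A q

-- Deletion–contraction holds for the counting functions themselves: a
-- homomorphism nonvanishing on A ∖ {α} either kills α, and then it factors
-- through Γ/⟨α⟩ and is counted by χ_{A″}, or it does not, and it is counted
-- by χ_A. Hence χ_{A′}(q) = χ_A(q) + χ_{A″}(q) for every q. All LCM-periods
-- are positive, so on the infinite progression q ≡ k mod ρρ′ρ″ the three
-- constituents agree with the three counting functions, and a polynomial with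
-- infinitely many roots is zero.
module Submission where

open import Defs
open import Data.Nat using (ℕ; _≤_)
open import Data.Integer using (ℤ; _-_)
open import Data.Vec using (Vec)
open import Data.List using (List; _∷_; length; lookup; removeAt)
open import Data.Fin using (Fin)
open import Relation.Binary.PropositionalEquality using (_≡_)

open import Data.Bool using (Bool; true; false; T; T?; _∧_; not)
open import Data.Bool.Properties using (∧-assoc)
open import Data.Empty using (⊥-elim)
open import Data.Fin as Fin using ()
open import Data.Integer as ℤ using (+_; 0ℤ; -_)
import Data.Integer.Divisibility as ℤ
import Data.Integer.Properties as ℤ
open import Data.Integer.Tactic.RingSolver using (solve-∀)
open import Data.List as List using ([]; filterᵇ)
open import Data.List.Properties using (filter-≐)
open import Data.List.Relation.Unary.All using (All; _∷_)
open import Data.Nat as ℕ using (zero; suc; s≤s; NonZero)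
open import Data.Nat.Divisibility as ℕ using (divides; m∣m*n; n∣m*n; ∣-refl; ∣-trans)
import Data.Nat.Properties as ℕ
open import Data.Product using (_,_)
open import Data.Sum using (inj₁; inj₂)
open import Data.Vec using ([]; _∷_)
open import Function using (_∘_)
open import Function.Definitions using (Injective)
open import Relation.Binary.PropositionalEquality
  using (refl; sym; trans; cong; cong₂; subst; _≢_; module ≡-Reasoning)
open ≡-Reasoning

-- For p = a ∷ p′ this is the quotient of p by t - r; it does not depend on a.
quotientByLinear : List ℤ → ℤ → List ℤ
quotientByLinear [] r = []
quotientByLinear (b ∷ p) r = eval (b ∷ p) r ∷ quotientByLinear p r

length-quotientByLinear : ∀ p r → length (quotientByLinear p r) ≡ length p
length-quotientByLinear [] r = refl
length-quotientByLinear (b ∷ p) r = cong suc (length-quotientByLinear p r)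

eval-quotientByLinear : ∀ a p r t →
  eval (a ∷ p) t ≡ eval (a ∷ p) r ℤ.+ (t - r) ℤ.* eval (quotientByLinear p r) t
eval-quotientByLinear a [] r t = step a t r
  where
  step : ∀ a t r → a ℤ.+ t ℤ.* 0ℤ ≡ (a ℤ.+ r ℤ.* 0ℤ) ℤ.+ (t - r) ℤ.* 0ℤ
  step = solve-∀
eval-quotientByLinear a (b ∷ p) r t = begin
  a ℤ.+ t ℤ.* eval (b ∷ p) t
    ≡⟨ cong (λ x → a ℤ.+ t ℤ.* x) (eval-quotientByLinear b p r t) ⟩
  a ℤ.+ t ℤ.* (eval (b ∷ p) r ℤ.+ (t - r) ℤ.* eval (quotientByLinear p r) t)
    ≡⟨ step a t r (eval (b ∷ p) r) (eval (quotientByLinear p r) t) ⟩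
  (a ℤ.+ r ℤ.* eval (b ∷ p) r) ℤ.+ (t - r) ℤ.* (eval (b ∷ p) r ℤ.+ t ℤ.* eval (quotientByLinear p r) t)
    ∎
  where
  step : ∀ a t r e h →
    a ℤ.+ t ℤ.* (e ℤ.+ (t - r) ℤ.* h) ≡ (a ℤ.+ r ℤ.* e) ℤ.+ (t - r) ℤ.* (e ℤ.+ t ℤ.* h)
  step = solve-∀

root-quotientByLinear : ∀ a p r t → eval (a ∷ p) r ≡ 0ℤ → eval (a ∷ p) t ≡ 0ℤ → t ≢ r →
  eval (quotientByLinear p r) t ≡ 0ℤ
root-quotientByLinear a p r t root-r root-t t≢r
  with ℤ.i*j≡0⇒i≡0∨j≡0 (t - r) product≡0
  where
  product≡0 : (t - r) ℤ.* eval (quotientByLinear p r) t ≡ 0ℤ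
  product≡0 = begin
    (t - r) ℤ.* eval (quotientByLinear p r) t                      ≡⟨ sym (ℤ.+-identityˡ _) ⟩
    0ℤ ℤ.+ (t - r) ℤ.* eval (quotientByLinear p r) t              ≡⟨ cong (ℤ._+ _) (sym root-r) ⟩
    eval (a ∷ p) r ℤ.+ (t - r) ℤ.* eval (quotientByLinear p r) t  ≡⟨ sym (eval-quotientByLinear a p r t) ⟩
    eval (a ∷ p) t                                                 ≡⟨ root-t ⟩
    0ℤ                                                             ∎
... | inj₁ t-r≡0 = ⊥-elim (t≢r (ℤ.i-j≡0⇒i≡j t r t-r≡0))
... | inj₂ value≡0 = value≡0

eval≡0-of-injectiveRoots : ∀ p (s : ℕ → ℤ) → Injective _≡_ _≡_ s →
  (∀ j → eval p (s j) ≡ 0ℤ) → ∀ t → eval p t ≡ 0ℤ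
eval≡0-of-injectiveRoots p = go (length p) p refl
  where
  go : ∀ n p → length p ≡ n → (s : ℕ → ℤ) → Injective _≡_ _≡_ s →
    (∀ j → eval p (s j) ≡ 0ℤ) → ∀ t → eval p t ≡ 0ℤ
  go _ [] _ s s-inj roots t = refl
  go (suc n) (a ∷ p) len s s-inj roots t = begin
    eval (a ∷ p) t                                                   ≡⟨ eval-quotientByLinear a p r t ⟩
    eval (a ∷ p) r ℤ.+ (t - r) ℤ.* eval (quotientByLinear p r) t    ≡⟨ cong₂ (λ x y → x ℤ.+ (t - r) ℤ.* y) (roots 0) (quotient≡0 t) ⟩
    0ℤ ℤ.+ (t - r) ℤ.* 0ℤ                                            ≡⟨ ℤ.+-identityˡ _ ⟩
    (t - r) ℤ.* 0ℤ                                                   ≡⟨ ℤ.*-zeroʳ (t - r) ⟩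
    0ℤ                                                               ∎
    where
    r = s 0
    quotient≡0 : ∀ t → eval (quotientByLinear p r) t ≡ 0ℤ
    quotient≡0 = go n (quotientByLinear p r)
      (trans (length-quotientByLinear p r) (ℕ.suc-injective len))
      (s ∘ suc) (ℕ.suc-injective ∘ s-inj)
      (λ j → root-quotientByLinear a p r (s (suc j)) (roots 0) (roots (suc j)) (ℕ.1+n≢0 ∘ s-inj))

negₚ : List ℤ → List ℤ
negₚ = List.map (λ a → - a)

eval-negₚ : ∀ p t → eval (negₚ p) t ≡ - eval p t
eval-negₚ [] t = refl
eval-negₚ (a ∷ p) t = begin
  - a ℤ.+ t ℤ.* eval (negₚ p) t  ≡⟨ cong (λ x → - a ℤ.+ t ℤ.* x) (eval-negₚ p t) ⟩
  - a ℤ.+ t ℤ.* - eval p t       ≡⟨ step a t (eval p t) ⟩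
  - (a ℤ.+ t ℤ.* eval p t)       ∎
  where
  step : ∀ a t x → - a ℤ.+ t ℤ.* - x ≡ - (a ℤ.+ t ℤ.* x)
  step = solve-∀

infixl 6 _-ₚ_
_-ₚ_ : List ℤ → List ℤ → List ℤ
[] -ₚ q = negₚ q
(a ∷ p) -ₚ [] = a ∷ p
(a ∷ p) -ₚ (b ∷ q) = (a - b) ∷ (p -ₚ q)

eval-minusₚ : ∀ p q t → eval (p -ₚ q) t ≡ eval p t - eval q t
eval-minusₚ [] q t = trans (eval-negₚ q t) (sym (ℤ.+-identityˡ _))
eval-minusₚ (a ∷ p) [] t = sym (ℤ.+-identityʳ _)
eval-minusₚ (a ∷ p) (b ∷ q) t = begin
  (a - b) ℤ.+ t ℤ.* eval (p -ₚ q) t            ≡⟨ cong (λ x → (a - b) ℤ.+ t ℤ.* x) (eval-minusₚ p q t) ⟩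
  (a - b) ℤ.+ t ℤ.* (eval p t - eval q t)      ≡⟨ step a b t (eval p t) (eval q t) ⟩
  (a ℤ.+ t ℤ.* eval p t) - (b ℤ.+ t ℤ.* eval q t) ∎
  where
  step : ∀ a b t x y → (a - b) ℤ.+ t ℤ.* (x - y) ≡ (a ℤ.+ t ℤ.* x) - (b ℤ.+ t ℤ.* y)
  step = solve-∀

eval-unique-of-injectiveAgreement : ∀ p q (s : ℕ → ℤ) → Injective _≡_ _≡_ s →
  (∀ j → eval p (s j) ≡ eval q (s j)) → ∀ t → eval p t ≡ eval q t
eval-unique-of-injectiveAgreement p q s s-inj agree t =
  ℤ.i-j≡0⇒i≡j _ _ (trans (sym (eval-minusₚ p q t))
    (eval≡0-of-injectiveRoots (p -ₚ q) s s-inj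
      (λ j → trans (eval-minusₚ p q (s j)) (ℤ.i≡j⇒i-j≡0 (agree j))) t))

+[m+n]-+m≡+n : ∀ m n → + (m ℕ.+ n) - + m ≡ + n
+[m+n]-+m≡+n m n = trans (cong (_- + m) (ℤ.pos-+ m n)) (cancel (+ m) (+ n))
  where
  cancel : ∀ a b → (a ℤ.+ b) - a ≡ b
  cancel = solve-∀

length-filterᵇ-split : ∀ {X : Set} (b p : X → Bool) xs →
  length (filterᵇ p xs)
    ≡ length (filterᵇ (λ x → b x ∧ p x) xs) ℕ.+ length (filterᵇ (λ x → not (b x) ∧ p x) xs)
length-filterᵇ-split b p [] = refl
length-filterᵇ-split b p (x ∷ xs) with b x | p x
... | true  | true  = cong suc (length-filterᵇ-split b p xs)
... | false | true  = trans (cong suc (length-filterᵇ-split b p xs)) (sym (ℕ.+-suc _ _))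
... | true  | false = length-filterᵇ-split b p xs
... | false | false = length-filterᵇ-split b p xs

filterᵇ-cong : ∀ {X : Set} {p q : X → Bool} → (∀ x → p x ≡ q x) → ∀ xs → filterᵇ p xs ≡ filterᵇ q xs
filterᵇ-cong {p = p} {q} p≗q =
  filter-≐ (T? ∘ p) (T? ∘ q) ((λ {x} → subst T (p≗q x)) , (λ {x} → subst T (sym (p≗q x))))

∧-leftSwap : ∀ x y z → x ∧ (y ∧ z) ≡ y ∧ (x ∧ z)
∧-leftSwap true  y z = refl
∧-leftSwap false true  z = refl
∧-leftSwap false false z = refl

allᵇ-removeAt : ∀ {X : Set} (f : X → Bool) (A : List X) (i : Fin (length A)) →
  allᵇ f A ≡ f (lookup A i) ∧ allᵇ f (removeAt A i)
allᵇ-removeAt f (x ∷ A) Fin.zero = refl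
allᵇ-removeAt f (x ∷ A) (Fin.suc i) = begin
  f x ∧ allᵇ f A                                  ≡⟨ cong (f x ∧_) (allᵇ-removeAt f A i) ⟩
  f x ∧ (f (lookup A i) ∧ allᵇ f (removeAt A i))  ≡⟨ ∧-leftSwap (f x) (f (lookup A i)) _ ⟩
  f (lookup A i) ∧ (f x ∧ allᵇ f (removeAt A i))  ∎

chi-deletion-contraction : ∀ m (R A : List (Vec ℤ m)) (i : Fin (length A)) (q : ℕ) .{{_ : NonZero q}} →
  chi m R (removeAt A i) q ≡ chi m (lookup A i ∷ R) (removeAt A i) q ℕ.+ chi m R A q
chi-deletion-contraction m R A i q =
  trans (length-filterᵇ-split killsα good′ (allVecs q m))
    (cong₂ ℕ._+_ (cong length (filterᵇ-cong goodForContraction (allVecs q m)))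
                 (cong length (filterᵇ-cong goodForA (allVecs q m))))
  where
  killsR killsα nonzeroOnA′ good′ : Vec (Fin q) m → Bool
  killsR c = allᵇ (isZeroAt q c) R
  killsα c = isZeroAt q c (lookup A i)
  nonzeroOnA′ c = allᵇ (λ b → not (isZeroAt q c b)) (removeAt A i)
  good′ c = killsR c ∧ nonzeroOnA′ c
  goodForA : ∀ c → not (killsα c) ∧ good′ c ≡ killsR c ∧ allᵇ (λ b → not (isZeroAt q c b)) A
  goodForA c = trans (∧-leftSwap (not (killsα c)) (killsR c) (nonzeroOnA′ c))
    (cong (killsR c ∧_) (sym (allᵇ-removeAt (λ b → not (isZeroAt q c b)) A i)))
  goodForContraction : ∀ c → killsα c ∧ good′ c ≡ (killsα c ∧ killsR c) ∧ nonzeroOnA′ c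
  goodForContraction c = sym (∧-assoc (killsα c) (killsR c) (nonzeroOnA′ c))

chi-as-difference : ∀ m (R A : List (Vec ℤ m)) (i : Fin (length A)) (q : ℕ) .{{_ : NonZero q}} →
  + chi m R A q ≡ + chi m R (removeAt A i) q - + chi m (lookup A i ∷ R) (removeAt A i) q
chi-as-difference m R A i q = begin
  + χ                   ≡⟨ sym (+[m+n]-+m≡+n χ″ χ) ⟩
  + (χ″ ℕ.+ χ) - + χ″   ≡⟨ cong (λ x → + x - + χ″) (sym (chi-deletion-contraction m R A i q)) ⟩
  + χ′ - + χ″           ∎
  where
  χ = chi m R A q
  χ′ = chi m R (removeAt A i) q
  χ″ = chi m (lookup A i ∷ R) (removeAt A i) q

productOverMasks : ∀ n → (Vec Bool n → ℕ) → ℕ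
productOverMasks zero f = f []
productOverMasks (suc n) f =
  productOverMasks n (f ∘ (true ∷_)) ℕ.* productOverMasks n (f ∘ (false ∷_))

∣-productOverMasks : ∀ n f s → f s ℕ.∣ productOverMasks n f
∣-productOverMasks zero f [] = ∣-refl
∣-productOverMasks (suc n) f (true ∷ s) =
  ∣-trans (∣-productOverMasks n (f ∘ (true ∷_)) s) (m∣m*n _)
∣-productOverMasks (suc n) f (false ∷ s) =
  ∣-trans (∣-productOverMasks n (f ∘ (false ∷_)) s) (n∣m*n (productOverMasks n (f ∘ (true ∷_))))

productOverMasks-nonZero : ∀ n f → (∀ s → NonZero (f s)) → NonZero (productOverMasks n f)
productOverMasks-nonZero zero f f≢0 = f≢0 []
productOverMasks-nonZero (suc n) f f≢0 =
  ℕ.m*n≢0 _ _ {{productOverMasks-nonZero n _ (f≢0 ∘ (true ∷_))}}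
              {{productOverMasks-nonZero n _ (f≢0 ∘ (false ∷_))}}

lastOr1-nonZero : ∀ {ds} → All (1 ℕ.<_) ds → NonZero (lastOr1 ds)
lastOr1-nonZero {[]} _ = _
lastOr1-nonZero {d ∷ []} (s≤s _ ∷ _) = _
lastOr1-nonZero {d ∷ e ∷ ds} (_ ∷ 1<ds) = lastOr1-nonZero 1<ds

divisor-nonZero : ∀ {m n} .{{_ : NonZero n}} → m ℕ.∣ n → NonZero m
divisor-nonZero {m} (divides k refl) = ℕ.m*n≢0⇒n≢0 k

lcmPeriod-nonZero : ∀ {m} R A {ρ} → IsLCMPeriod m R A ρ → NonZero ρ
lcmPeriod-nonZero R A (d , isLast , _ , least) =
  divisor-nonZero {{productOverMasks-nonZero (length A) d d≢0}}
    (least _ (∣-productOverMasks (length A) d))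
  where
  d≢0 : ∀ s → NonZero (d s)
  d≢0 s with isLast s
  ... | ds , _ , 1<ds , _ , _ , ds≡last = subst NonZero (sym ds≡last) (lastOr1-nonZero 1<ds)

progression-congruent : ∀ {d M} k n → d ℕ.∣ M → + d ℤ.∣ (+ (k ℕ.+ n ℕ.* M) - + k)
progression-congruent {d} {M} k n d∣M =
  subst (λ x → d ℕ.∣ ℤ.∣ x ∣) (sym (+[m+n]-+m≡+n k (n ℕ.* M))) (∣-trans d∣M (n∣m*n n))

progression-injective : ∀ k M .{{_ : NonZero M}} → Injective _≡_ _≡_ (λ n → + (k ℕ.+ n ℕ.* M))
progression-injective k M eq = ℕ.*-cancelʳ-≡ _ _ M (ℕ.+-cancelˡ-≡ k _ _ (ℤ.+-injective eq))

corollary3p9 : (m : ℕ) (R : List (Vec ℤ m)) (A : List (Vec ℤ m)) (i : Fin (length A))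
    → (ρ ρ′ ρ″ : ℕ)
    → IsLCMPeriod m R A ρ
    → IsLCMPeriod m R (removeAt A i) ρ′
    → IsLCMPeriod m (lookup A i ∷ R) (removeAt A i) ρ″
    → (k : ℕ) → 1 ≤ k → k ≤ ρ′ → k ≤ ρ″
    → (P P′ P″ : List ℤ)
    → IsConstituent m R A ρ k P
    → IsConstituent m R (removeAt A i) ρ′ k P′
    → IsConstituent m (lookup A i ∷ R) (removeAt A i) ρ″ k P″
    → (t : ℤ) → eval P t ≡ eval P′ t - eval P″ t
corollary3p9 m R A i ρ ρ′ ρ″ hρ hρ′ hρ″ (suc k) (s≤s _) _ _ P P′ P″ cP cP′ cP″ t = begin
  eval P t               ≡⟨ eval-unique-of-injectiveAgreement P (P′ -ₚ P″) (+_ ∘ q)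
                              (progression-injective (suc k) M) agree t ⟩
  eval (P′ -ₚ P″) t      ≡⟨ eval-minusₚ P′ P″ t ⟩
  eval P′ t - eval P″ t  ∎
  where
  M = ρ ℕ.* ρ′ ℕ.* ρ″
  instance
    M≢0 : NonZero M
    M≢0 = ℕ.m*n≢0 _ _ {{ℕ.m*n≢0 _ _ {{lcmPeriod-nonZero R A hρ}}
                                    {{lcmPeriod-nonZero R (removeAt A i) hρ′}}}}
                      {{lcmPeriod-nonZero (lookup A i ∷ R) (removeAt A i) hρ″}}
  ρ∣M : ρ ℕ.∣ M
  ρ∣M = ∣-trans (m∣m*n ρ′) (m∣m*n ρ″)
  ρ′∣M : ρ′ ℕ.∣ M
  ρ′∣M = ∣-trans (n∣m*n ρ) (m∣m*n ρ″)
  ρ″∣M : ρ″ ℕ.∣ M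
  ρ″∣M = n∣m*n (ρ ℕ.* ρ′)
  q : ℕ → ℕ
  q n = suc k ℕ.+ n ℕ.* M
  agree : ∀ n → eval P (+ q n) ≡ eval (P′ -ₚ P″) (+ q n)
  agree n = begin
    eval P (+ q n)                      ≡⟨ cP (q n) (progression-congruent (suc k) n ρ∣M) ⟩
    + chi m R A (q n)                   ≡⟨ chi-as-difference m R A i (q n) ⟩
    + chi m R (removeAt A i) (q n) - + chi m (lookup A i ∷ R) (removeAt A i) (q n)
                                        ≡⟨ sym (cong₂ _-_ (cP′ (q n) (progression-congruent (suc k) n ρ′∣M))
                                                         (cP″ (q n) (progression-congruent (suc k) n ρ″∣M))) ⟩
    eval P′ (+ q n) - eval P″ (+ q n)   ≡⟨ sym (eval-minusₚ P′ P″ (+ q n)) ⟩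
    eval (P′ -ₚ P″) (+ q n)             ∎
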